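{- Let $X\in\{0,1\}^{n\times n}$ be nonsingular and let $X=[\,X_1\mid X_2\,]$ with $X_1\in\{0,1\}^{n\times k}$, $X_2\in\{0,1\}^{n\times(n-k)}$ for some $1\le k<n$. Suppose $X_1^\top X_2=0$ (so that $X^\top X=\begin{bmatrix}X_1^\top X_1&0\\0&X_2^\top X_2\end{bmatrix}$). Then there exists a permutation matrix $\Pi$ such that \[\Pi X=\begin{bmatrix}X_{11}&0\\0&X_{22}\end{bmatrix}\] with $X_{11}\in\{0,1\}^{k\times k}$ and $X_{22}\in\{0,1\}^{(n-k)\times(n-k)}$ both nonsingular. -}

module Defs where

open import Data.Bool using (Bool; true; false)
open import Data.Nat using (ℕ; zero; suc)
open import Data.Integer using (ℤ; +_; _+_; _*_; -_)
open import Relation.Binary.PropositionalEquality using (_≡_)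
open import Relation.Nullary using (¬_)
open import Data.Fin using (Fin; zero; suc; punchIn; toℕ)

Matrix : Set → ℕ → ℕ → Set
Matrix A m n = Fin m → Fin n → A

-- 0/1 entries are represented by Bool (false = 0, true = 1); interpret in ℤ.
b2ℤ : Bool → ℤ
b2ℤ false = + 0
b2ℤ true  = + 1

toℤMat : ∀ {m n} → Matrix Bool m n → Matrix ℤ m n
toℤMat X i j = b2ℤ (X i j)

∑ : ∀ n → (Fin n → ℤ) → ℤ
∑ zero    f = + 0
∑ (suc n) f = f zero + ∑ n (λ i → f (suc i))

sign : ℕ → ℤ
sign zero    = + 1
sign (suc i) = - sign i

det : ∀ n → Matrix ℤ n n → ℤ
det zero    M = + 1
det (suc n) M = ∑ (suc n) (λ j → sign (toℕ j) * (M zero j * det n (λ r c → M (suc r) (punchIn j c))))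

-- A square 0/1 matrix is nonsingular iff its determinant (an integer, the same
-- value as over ℝ or ℚ) is nonzero.
Nonsingular : ∀ {n} → Matrix Bool n n → Set
Nonsingular {n} X = ¬ (det n (toℤMat X) ≡ + 0)

module Submission where

-- For 0/1 columns, X₁ᵀX₂ = 0 says that no row has a 1 both in X₁ and
-- in X₂.  Sort the rows stably into the p "left" rows, which have no 1 in
-- X₂, and the q "right" rows, which do (hence vanish on X₁).  Relative to
-- this sorting X is block shaped: left rows vanish on the columns ≥ k and
-- right rows on the columns < k.
--
-- A sorting of the rows is a
-- `Shuffle p q n`; by induction on it, expanding along row 0 (a left or a
-- right row), we prove for block-shaped matrices
--   * `block-singular`: if p ≢ k the determinant is 0;
--   * `block-det`: if p = k it is ± det(left block) · det(right block).
-- Nonsingularity of X forces p = k and q = m, the shuffle yields the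
-- permutation Π (`shufflePermutation`), the off-diagonal blocks of ΠX vanish
-- by the choice of the sorting, and the product formula shows that both
-- diagonal blocks are nonsingular.

open import Defs
open import Data.Bool using (Bool; true; false; _∧_)
open import Data.Bool.Properties using (¬-not) renaming (_≟_ to _≟ᵇ_)
open import Data.Nat using (ℕ; zero; suc; _+_; _≤_; _<_; z≤n; s≤s; _<?_; _≟_)
import Data.Nat.Properties as ℕP
open import Data.Integer as ℤ using (ℤ; +_; _*_; -_)
import Data.Integer.Properties as ℤP
open import Data.Integer.Tactic.RingSolver using (solve-∀)
open import Data.Fin using (Fin; zero; suc; punchIn; toℕ; _↑ˡ_; _↑ʳ_; cast; splitAt; join)
import Data.Fin.Properties as FP
open import Data.Fin.Permutation using (Permutation′; _⟨$⟩ʳ_; permutation)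
open import Data.Product using (Σ; _×_; _,_; proj₁; proj₂)
open import Data.Sum using (_⊎_; inj₁; inj₂; [_,_]) renaming (map to ⊎-map)
open import Data.Empty using (⊥-elim)
open import Function using (_∘_)
open import Relation.Binary.PropositionalEquality hiding ([_])
open import Relation.Nullary using (¬_; yes; no; Dec)

∑-cong : ∀ n {f g : Fin n → ℤ} → (∀ i → f i ≡ g i) → ∑ n f ≡ ∑ n g
∑-cong zero    f≗g = refl
∑-cong (suc n) f≗g = cong₂ ℤ._+_ (f≗g zero) (∑-cong n (f≗g ∘ suc))

∑-vanishes : ∀ n {f : Fin n → ℤ} → (∀ i → f i ≡ + 0) → ∑ n f ≡ + 0
∑-vanishes zero    f≡0 = refl
∑-vanishes (suc n) f≡0 = cong₂ ℤ._+_ (f≡0 zero) (∑-vanishes n (f≡0 ∘ suc))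

∑-*ˡ : ∀ n a (f : Fin n → ℤ) → ∑ n (λ i → a * f i) ≡ a * ∑ n f
∑-*ˡ zero    a f = sym (ℤP.*-zeroʳ a)
∑-*ˡ (suc n) a f = trans (cong (ℤ._+_ (a * f zero)) (∑-*ˡ n a (f ∘ suc)))
                         (sym (ℤP.*-distribˡ-+ a (f zero) _))

∑-*ʳ : ∀ n a (f : Fin n → ℤ) → ∑ n (λ i → f i * a) ≡ ∑ n f * a
∑-*ʳ zero    a f = refl
∑-*ʳ (suc n) a f = trans (cong (ℤ._+_ (f zero * a)) (∑-*ʳ n a (f ∘ suc)))
                         (sym (ℤP.*-distribʳ-+ a (f zero) _))

∑-++ : ∀ k q (f : Fin (k + q) → ℤ) →
       ∑ (k + q) f ≡ ∑ k (λ i → f (i ↑ˡ q)) ℤ.+ ∑ q (λ j → f (k ↑ʳ j))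
∑-++ zero    q f = sym (ℤP.+-identityˡ _)
∑-++ (suc k) q f = trans (cong (ℤ._+_ (f zero)) (∑-++ k q (f ∘ suc)))
                         (sym (ℤP.+-assoc (f zero) _ _))

b2ℤ-∧ : ∀ x y → b2ℤ x * b2ℤ y ≡ b2ℤ (x ∧ y)
b2ℤ-∧ false _ = refl
b2ℤ-∧ true false = refl
b2ℤ-∧ true true = refl

∑-b2ℤ-natural : ∀ n (g : Fin n → Bool) → Σ ℕ λ c → ∑ n (b2ℤ ∘ g) ≡ + c
∑-b2ℤ-natural zero    g = 0 , refl
∑-b2ℤ-natural (suc n) g with ∑-b2ℤ-natural n (g ∘ suc) | g zero
... | c , rest≡c | false = c , trans (ℤP.+-identityˡ _) rest≡c
... | c , rest≡c | true  = suc c , cong (ℤ._+_ (+ 1)) rest≡c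

∑-b2ℤ-zero : ∀ n (g : Fin n → Bool) → ∑ n (b2ℤ ∘ g) ≡ + 0 → ∀ r → g r ≡ false
∑-b2ℤ-zero (suc n) g sum≡0 r with g zero in g0 | ∑-b2ℤ-natural n (g ∘ suc)
... | true | c , rest≡c with trans (sym (cong (ℤ._+_ (+ 1)) rest≡c)) sum≡0
...   | ()
∑-b2ℤ-zero (suc n) g sum≡0 zero    | false | _ = g0
∑-b2ℤ-zero (suc n) g sum≡0 (suc r) | false | _ =
  ∑-b2ℤ-zero n (g ∘ suc) (trans (sym (ℤP.+-identityˡ _)) sum≡0) r

minor : ∀ {n} → Matrix ℤ (suc n) (suc n) → Fin (suc n) → Matrix ℤ n n
minor M c r d = M (suc r) (punchIn c d)

cofactorTerm : ∀ {n} → Matrix ℤ (suc n) (suc n) → Fin (suc n) → ℤ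
cofactorTerm {n} M c = sign (toℕ c) * (M zero c * det n (minor M c))

cofactorTerm-entry0 : ∀ {n} (M : Matrix ℤ (suc n) (suc n)) c →
                      M zero c ≡ + 0 → cofactorTerm M c ≡ + 0
cofactorTerm-entry0 M c entry≡0 rewrite entry≡0 = ℤP.*-zeroʳ (sign (toℕ c))

cofactorTerm-minor0 : ∀ {n} (M : Matrix ℤ (suc n) (suc n)) c →
                      det n (minor M c) ≡ + 0 → cofactorTerm M c ≡ + 0
cofactorTerm-minor0 M c minor≡0 rewrite minor≡0 | ℤP.*-zeroʳ (M zero c) =
  ℤP.*-zeroʳ (sign (toℕ c))

det-cong : ∀ n {M N : Matrix ℤ n n} → (∀ r c → M r c ≡ N r c) → det n M ≡ det n N
det-cong zero    M≗N = refl
det-cong (suc n) M≗N = ∑-cong (suc n) λ c →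
  cong₂ (λ x d → sign (toℕ c) * (x * d)) (M≗N zero c) (det-cong n λ r d → M≗N (suc r) (punchIn c d))

sign-+ : ∀ a b → sign (a + b) ≡ sign a * sign b
sign-+ zero    b = sym (ℤP.*-identityˡ _)
sign-+ (suc a) b = trans (cong -_ (sign-+ a b)) (ℤP.neg-distribˡ-* (sign a) (sign b))

nonzero-factors : ∀ {d ε a b : ℤ} → ¬ d ≡ + 0 → d ≡ ε * (a * b) → ¬ a ≡ + 0 × ¬ b ≡ + 0
nonzero-factors {ε = ε} {a} d≢0 d≡εab =
  (λ { refl → d≢0 (trans d≡εab (ℤP.*-zeroʳ ε)) }) ,
  (λ { refl → d≢0 (trans d≡εab (trans (cong (ε *_) (ℤP.*-zeroʳ a)) (ℤP.*-zeroʳ ε))) })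

-- `punchIn` computed on indices.  The block arguments only need how it
-- moves an index below, at or above the deleted position.
punchInℕ : ℕ → ℕ → ℕ
punchInℕ zero    y       = suc y
punchInℕ (suc x) zero    = zero
punchInℕ (suc x) (suc y) = suc (punchInℕ x y)

toℕ-punchIn : ∀ {n} (i : Fin (suc n)) (j : Fin n) → toℕ (punchIn i j) ≡ punchInℕ (toℕ i) (toℕ j)
toℕ-punchIn zero    j       = refl
toℕ-punchIn (suc i) zero    = refl
toℕ-punchIn (suc i) (suc j) = cong suc (toℕ-punchIn i j)

punchInℕ-below : ∀ x y → y < x → punchInℕ x y ≡ y
punchInℕ-below (suc x) zero    _         = refl
punchInℕ-below (suc x) (suc y) (s≤s y<x) = cong suc (punchInℕ-below x y y<x)

punchInℕ-above : ∀ x y → x ≤ y → punchInℕ x y ≡ suc y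
punchInℕ-above zero    y       _         = refl
punchInℕ-above (suc x) (suc y) (s≤s x≤y) = cong suc (punchInℕ-above x y x≤y)

punchInℕ-≥ : ∀ x y → y ≤ punchInℕ x y
punchInℕ-≥ zero    y       = ℕP.n≤1+n y
punchInℕ-≥ (suc x) zero    = z≤n
punchInℕ-≥ (suc x) (suc y) = s≤s (punchInℕ-≥ x y)

punchInℕ-≤ : ∀ x y → punchInℕ x y ≤ suc y
punchInℕ-≤ zero    y       = ℕP.≤-refl
punchInℕ-≤ (suc x) zero    = z≤n
punchInℕ-≤ (suc x) (suc y) = s≤s (punchInℕ-≤ x y)

punchInℕ-shift : ∀ k x y → punchInℕ (k + x) (k + y) ≡ k + punchInℕ x y
punchInℕ-shift zero    x y = refl
punchInℕ-shift (suc k) x y = cong suc (punchInℕ-shift k x y)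

-- Shuffles: a splitting of Fin n into an order-preserving copy of Fin p
-- (the "left" rows, embedded by `lft`) and one of Fin q (the "right" rows,
-- embedded by `rgt`).
data Shuffle : ℕ → ℕ → ℕ → Set where
  done : Shuffle 0 0 0
  L    : ∀ {p q n} → Shuffle p q n → Shuffle (suc p) q (suc n)
  R    : ∀ {p q n} → Shuffle p q n → Shuffle p (suc q) (suc n)

lft : ∀ {p q n} → Shuffle p q n → Fin p → Fin n
lft (L s) zero    = zero
lft (L s) (suc i) = suc (lft s i)
lft (R s) i       = suc (lft s i)

rgt : ∀ {p q n} → Shuffle p q n → Fin q → Fin n
rgt (L s) j       = suc (rgt s j)
rgt (R s) zero    = zero
rgt (R s) (suc j) = suc (rgt s j)

size : ∀ {p q n} → Shuffle p q n → n ≡ p + q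
size done = refl
size (L s) = cong suc (size s)
size {p} {suc q} (R s) = trans (cong suc (size s)) (sym (ℕP.+-suc p q))

-- The sign of the shuffle, as a permutation of rows: each right row is moved
-- past all the left rows coming after it.
shuffleSign : ∀ {p q n} → Shuffle p q n → ℤ
shuffleSign done  = + 1
shuffleSign (L s) = shuffleSign s
shuffleSign {p} (R s) = sign p * shuffleSign s

leftColumn : ∀ {p q n} → Shuffle p q n → Fin p → Fin n
leftColumn {q = q} s b = cast (sym (size s)) (b ↑ˡ q)

rightColumn : ∀ {p q n} → Shuffle p q n → Fin q → Fin n
rightColumn {p} s b = cast (sym (size s)) (p ↑ʳ b)

toℕ-leftColumn : ∀ {p q n} (s : Shuffle p q n) b → toℕ (leftColumn s b) ≡ toℕ b
toℕ-leftColumn {q = q} s b = trans (FP.toℕ-cast (sym (size s)) (b ↑ˡ q)) (FP.toℕ-↑ˡ b q)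

toℕ-rightColumn : ∀ {p q n} (s : Shuffle p q n) b → toℕ (rightColumn s b) ≡ p + toℕ b
toℕ-rightColumn {p} s b = trans (FP.toℕ-cast (sym (size s)) (p ↑ʳ b)) (FP.toℕ-↑ʳ p b)

leftColumn-↑ˡ : ∀ {p q} (s : Shuffle p q (p + q)) b → leftColumn s b ≡ b ↑ˡ q
leftColumn-↑ˡ {q = q} s b = FP.cast-is-id (sym (size s)) (b ↑ˡ q)

rightColumn-↑ʳ : ∀ {p q} (s : Shuffle p q (p + q)) b → rightColumn s b ≡ p ↑ʳ b
rightColumn-↑ʳ {p} s b = FP.cast-is-id (sym (size s)) (p ↑ʳ b)

∑-columns : ∀ {p q n} (s : Shuffle p q n) (f : Fin n → ℤ) →
  ∑ n f ≡ ∑ p (f ∘ leftColumn s) ℤ.+ ∑ q (f ∘ rightColumn s)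
∑-columns {p} {q} s f = split (size s)
  where
  split : (e : _ ≡ p + q) →
    ∑ _ f ≡ ∑ p (λ b → f (cast (sym e) (b ↑ˡ q))) ℤ.+ ∑ q (λ b → f (cast (sym e) (p ↑ʳ b)))
  split refl = trans (∑-++ p q f)
    (cong₂ ℤ._+_ (∑-cong p λ b → cong f (sym (FP.cast-is-id refl _)))
                 (∑-cong q λ b → cong f (sym (FP.cast-is-id refl _))))

punchIn-left-left : ∀ {p q n} (s : Shuffle p q n) i b →
  punchIn (leftColumn (L s) i) (leftColumn s b) ≡ leftColumn (L s) (punchIn i b)
punchIn-left-left s i b = FP.toℕ-injective (begin
  toℕ (punchIn (leftColumn (L s) i) (leftColumn s b))         ≡⟨ toℕ-punchIn _ _ ⟩
  punchInℕ (toℕ (leftColumn (L s) i)) (toℕ (leftColumn s b))  ≡⟨ cong₂ punchInℕ (toℕ-leftColumn (L s) i) (toℕ-leftColumn s b) ⟩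
  punchInℕ (toℕ i) (toℕ b)                                    ≡⟨ toℕ-punchIn i b ⟨
  toℕ (punchIn i b)                                           ≡⟨ toℕ-leftColumn (L s) (punchIn i b) ⟨
  toℕ (leftColumn (L s) (punchIn i b))                        ∎)
  where open ≡-Reasoning

punchIn-left-right : ∀ {p q n} (s : Shuffle p q n) i b →
  punchIn (leftColumn (L s) i) (rightColumn s b) ≡ rightColumn (L s) b
punchIn-left-right {p} s i b = FP.toℕ-injective (begin
  toℕ (punchIn (leftColumn (L s) i) (rightColumn s b))         ≡⟨ toℕ-punchIn _ _ ⟩
  punchInℕ (toℕ (leftColumn (L s) i)) (toℕ (rightColumn s b))  ≡⟨ cong₂ punchInℕ (toℕ-leftColumn (L s) i) (toℕ-rightColumn s b) ⟩
  punchInℕ (toℕ i) (p + toℕ b)                                 ≡⟨ punchInℕ-above (toℕ i) (p + toℕ b) i≤p+b ⟩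
  suc p + toℕ b                                                ≡⟨ toℕ-rightColumn (L s) b ⟨
  toℕ (rightColumn (L s) b)                                    ∎)
  where
  open ≡-Reasoning
  i≤p+b : toℕ i ≤ p + toℕ b
  i≤p+b = ℕP.≤-trans (ℕP.≤-pred (FP.toℕ<n i)) (ℕP.m≤m+n p (toℕ b))

punchIn-right-left : ∀ {p q n} (s : Shuffle p q n) j b →
  punchIn (rightColumn (R s) j) (leftColumn s b) ≡ leftColumn (R s) b
punchIn-right-left {p} s j b = FP.toℕ-injective (begin
  toℕ (punchIn (rightColumn (R s) j) (leftColumn s b))         ≡⟨ toℕ-punchIn _ _ ⟩
  punchInℕ (toℕ (rightColumn (R s) j)) (toℕ (leftColumn s b))  ≡⟨ cong₂ punchInℕ (toℕ-rightColumn (R s) j) (toℕ-leftColumn s b) ⟩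
  punchInℕ (p + toℕ j) (toℕ b)                                 ≡⟨ punchInℕ-below (p + toℕ j) (toℕ b) b<p+j ⟩
  toℕ b                                                        ≡⟨ toℕ-leftColumn (R s) b ⟨
  toℕ (leftColumn (R s) b)                                     ∎)
  where
  open ≡-Reasoning
  b<p+j : toℕ b < p + toℕ j
  b<p+j = ℕP.<-≤-trans (FP.toℕ<n b) (ℕP.m≤m+n p (toℕ j))

punchIn-right-right : ∀ {p q n} (s : Shuffle p q n) j b →
  punchIn (rightColumn (R s) j) (rightColumn s b) ≡ rightColumn (R s) (punchIn j b)
punchIn-right-right {p} s j b = FP.toℕ-injective (begin
  toℕ (punchIn (rightColumn (R s) j) (rightColumn s b))         ≡⟨ toℕ-punchIn _ _ ⟩
  punchInℕ (toℕ (rightColumn (R s) j)) (toℕ (rightColumn s b))  ≡⟨ cong₂ punchInℕ (toℕ-rightColumn (R s) j) (toℕ-rightColumn s b) ⟩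
  punchInℕ (p + toℕ j) (p + toℕ b)                              ≡⟨ punchInℕ-shift p (toℕ j) (toℕ b) ⟩
  p + punchInℕ (toℕ j) (toℕ b)                                  ≡⟨ cong (_+_ p) (toℕ-punchIn j b) ⟨
  p + toℕ (punchIn j b)                                         ≡⟨ toℕ-rightColumn (R s) (punchIn j b) ⟨
  toℕ (rightColumn (R s) (punchIn j b))                         ∎)
  where open ≡-Reasoning

Block : ∀ {p q n} → Shuffle p q n → ℕ → Matrix ℤ n n → Set
Block s k M = (∀ i c → k ≤ toℕ c → M (lft s i) c ≡ + 0)
            × (∀ j c → toℕ c < k → M (rgt s j) c ≡ + 0)

minor-Block-L : ∀ {p q n k} (s : Shuffle p q n) (M : Matrix ℤ (suc n) (suc n)) →
  Block (L s) (suc k) M → ∀ c → toℕ c < suc k → Block s k (minor M c)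
minor-Block-L {k = k} s M (leftZero , rightZero) c c<1+k = leftZero′ , rightZero′
  where
  -- a column d ≥ k of the minor is a column ≥ k + 1 of M, since c ≤ k ≤ d
  leftZero′ : ∀ i d → k ≤ toℕ d → minor M c (lft s i) d ≡ + 0
  leftZero′ i d k≤d = leftZero (suc i) (punchIn c d) (subst (suc k ≤_) (sym d↦1+d) (s≤s k≤d))
    where
    d↦1+d = trans (toℕ-punchIn c d) (punchInℕ-above (toℕ c) (toℕ d) (ℕP.≤-trans (ℕP.≤-pred c<1+k) k≤d))
  -- a column d < k of the minor is a column ≤ d + 1 < k + 1 of M
  rightZero′ : ∀ j d → toℕ d < k → minor M c (rgt s j) d ≡ + 0
  rightZero′ j d d<k = rightZero j (punchIn c d) (subst (_< suc k) (sym (toℕ-punchIn c d))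
    (ℕP.≤-<-trans (punchInℕ-≤ (toℕ c) (toℕ d)) (s≤s d<k)))

minor-Block-R : ∀ {p q n k} (s : Shuffle p q n) (M : Matrix ℤ (suc n) (suc n)) →
  Block (R s) k M → ∀ c → k ≤ toℕ c → Block s k (minor M c)
minor-Block-R {k = k} s M (leftZero , rightZero) c k≤c = leftZero′ , rightZero′
  where
  -- a column d ≥ k of the minor is a column ≥ d ≥ k of M
  leftZero′ : ∀ i d → k ≤ toℕ d → minor M c (lft s i) d ≡ + 0
  leftZero′ i d k≤d = leftZero i (punchIn c d) (subst (k ≤_) (sym (toℕ-punchIn c d))
    (ℕP.≤-trans k≤d (punchInℕ-≥ (toℕ c) (toℕ d))))
  -- a column d < k of the minor is column d of M, since d < k ≤ c
  rightZero′ : ∀ j d → toℕ d < k → minor M c (rgt s j) d ≡ + 0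
  rightZero′ j d d<k = rightZero (suc j) (punchIn c d) (subst (_< k) (sym d↦d) d<k)
    where
    d↦d = trans (toℕ-punchIn c d) (punchInℕ-below (toℕ c) (toℕ d) (ℕP.<-≤-trans d<k k≤c))

block-singular : ∀ {p q n} (s : Shuffle p q n) k (M : Matrix ℤ n n) →
  Block s k M → k ≤ n → ¬ p ≡ k → det n M ≡ + 0
block-singular done zero M _ _ p≢k = ⊥-elim (p≢k refl)
block-singular {n = suc n} (L s) zero M (leftZero , _) _ _ =
  ∑-vanishes (suc n) λ c → cofactorTerm-entry0 M c (leftZero zero c z≤n)
block-singular {n = suc n} (L s) (suc k) M blk (s≤s k≤n) p≢k = ∑-vanishes (suc n) vanishes
  where
  vanishes : ∀ c → cofactorTerm M c ≡ + 0
  vanishes c with toℕ c <? suc k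
  ... | yes c<1+k = cofactorTerm-minor0 M c
          (block-singular s k (minor M c) (minor-Block-L s M blk c c<1+k) k≤n (p≢k ∘ cong suc))
  ... | no  c≮1+k = cofactorTerm-entry0 M c (proj₁ blk zero c (ℕP.≮⇒≥ c≮1+k))
block-singular {n = suc n} (R s) k M blk _ p≢k = ∑-vanishes (suc n) vanishes
  where
  vanishes : ∀ c → cofactorTerm M c ≡ + 0
  vanishes c with toℕ c <? k
  ... | yes c<k = cofactorTerm-entry0 M c (proj₂ blk zero c c<k)
  ... | no  c≮k = cofactorTerm-minor0 M c (block-singular s k (minor M c)
          (minor-Block-R s M blk c (ℕP.≮⇒≥ c≮k)) (ℕP.≤-trans (ℕP.≮⇒≥ c≮k) (ℕP.≤-pred (FP.toℕ<n c))) p≢k)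

leftBlock : ∀ {p q n} → Shuffle p q n → Matrix ℤ n n → Matrix ℤ p p
leftBlock s M a b = M (lft s a) (leftColumn s b)

rightBlock : ∀ {p q n} → Shuffle p q n → Matrix ℤ n n → Matrix ℤ q q
rightBlock s M a b = M (rgt s a) (rightColumn s b)

minor-leftBlock-L : ∀ {p q n} (s : Shuffle p q n) (M : Matrix ℤ (suc n) (suc n)) i a b →
  leftBlock s (minor M (leftColumn (L s) i)) a b ≡ minor (leftBlock (L s) M) i a b
minor-leftBlock-L s M i a b = cong (M (suc (lft s a))) (punchIn-left-left s i b)

minor-rightBlock-L : ∀ {p q n} (s : Shuffle p q n) (M : Matrix ℤ (suc n) (suc n)) i a b →
  rightBlock s (minor M (leftColumn (L s) i)) a b ≡ rightBlock (L s) M a b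
minor-rightBlock-L s M i a b = cong (M (suc (rgt s a))) (punchIn-left-right s i b)

minor-leftBlock-R : ∀ {p q n} (s : Shuffle p q n) (M : Matrix ℤ (suc n) (suc n)) j a b →
  leftBlock s (minor M (rightColumn (R s) j)) a b ≡ leftBlock (R s) M a b
minor-leftBlock-R s M j a b = cong (M (suc (lft s a))) (punchIn-right-left s j b)

minor-rightBlock-R : ∀ {p q n} (s : Shuffle p q n) (M : Matrix ℤ (suc n) (suc n)) j a b →
  rightBlock s (minor M (rightColumn (R s) j)) a b ≡ minor (rightBlock (R s) M) j a b
minor-rightBlock-R s M j a b = cong (M (suc (rgt s a))) (punchIn-right-right s j b)

BlockDet : ∀ {p q n} → Shuffle p q n → Set
BlockDet {p} {q} {n} s = ∀ M → Block s p M →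
  det n M ≡ shuffleSign s * (det p (leftBlock s M) * det q (rightBlock s M))

-- Inductive step when row 0 is a left row: only the left columns contribute
-- to the expansion along row 0, and each of their minors is block shaped.
block-det-L : ∀ {p q n} (s : Shuffle p q n) → BlockDet s → BlockDet (L s)
block-det-L {p} {q} {n} s blockDet-s M blk = begin
  det (suc n) M
    ≡⟨ ∑-columns (L s) (cofactorTerm M) ⟩
  ∑ (suc p) (cofactorTerm M ∘ leftColumn (L s)) ℤ.+ ∑ q (cofactorTerm M ∘ rightColumn (L s))
    ≡⟨ cong₂ ℤ._+_ (∑-cong (suc p) leftTerm) (∑-vanishes q rightTerm) ⟩
  ∑ (suc p) (λ i → ε * (cofactorTerm A i * det q B)) ℤ.+ + 0
    ≡⟨ ℤP.+-identityʳ _ ⟩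
  ∑ (suc p) (λ i → ε * (cofactorTerm A i * det q B))
    ≡⟨ ∑-*ˡ (suc p) ε (λ i → cofactorTerm A i * det q B) ⟩
  ε * ∑ (suc p) (λ i → cofactorTerm A i * det q B)
    ≡⟨ cong (ε *_) (∑-*ʳ (suc p) (det q B) (cofactorTerm A)) ⟩
  ε * (det (suc p) A * det q B) ∎
  where
  open ≡-Reasoning
  ε = shuffleSign s
  A = leftBlock (L s) M
  B = rightBlock (L s) M

  rightTerm : ∀ j → cofactorTerm M (rightColumn (L s) j) ≡ + 0
  rightTerm j = cofactorTerm-entry0 M _ (proj₁ blk zero _
    (subst (suc p ≤_) (sym (toℕ-rightColumn (L s) j)) (ℕP.m≤m+n (suc p) (toℕ j))))

  rearrange : ∀ (σ x ε a b : ℤ) → σ * (x * (ε * (a * b))) ≡ ε * ((σ * (x * a)) * b)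
  rearrange = solve-∀

  leftTerm : ∀ i → cofactorTerm M (leftColumn (L s) i) ≡ ε * (cofactorTerm A i * det q B)
  leftTerm i = begin
    cofactorTerm M c
      ≡⟨ cong₂ (λ σ d → σ * (A zero i * d)) (cong sign (toℕ-leftColumn (L s) i))
               (blockDet-s (minor M c) (minor-Block-L s M blk c c<1+p)) ⟩
    sign (toℕ i) * (A zero i * (ε * (det p (leftBlock s (minor M c)) * det q (rightBlock s (minor M c)))))
      ≡⟨ cong₂ (λ x y → sign (toℕ i) * (A zero i * (ε * (x * y))))
               (det-cong p (minor-leftBlock-L s M i)) (det-cong q (minor-rightBlock-L s M i)) ⟩
    sign (toℕ i) * (A zero i * (ε * (det p (minor A i) * det q B)))
      ≡⟨ rearrange (sign (toℕ i)) (A zero i) ε (det p (minor A i)) (det q B) ⟩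
    ε * (cofactorTerm A i * det q B) ∎
    where
    c = leftColumn (L s) i
    c<1+p = subst (_< suc p) (sym (toℕ-leftColumn (L s) i)) (FP.toℕ<n i)

-- Inductive step when row 0 is a right row: only the right columns
-- contribute; the column index p + j contributes the extra sign (-1)ᵖ.
block-det-R : ∀ {p q n} (s : Shuffle p q n) → BlockDet s → BlockDet (R s)
block-det-R {p} {q} {n} s blockDet-s M blk = begin
  det (suc n) M
    ≡⟨ ∑-columns (R s) (cofactorTerm M) ⟩
  ∑ p (cofactorTerm M ∘ leftColumn (R s)) ℤ.+ ∑ (suc q) (cofactorTerm M ∘ rightColumn (R s))
    ≡⟨ cong₂ ℤ._+_ (∑-vanishes p leftTerm) (∑-cong (suc q) rightTerm) ⟩
  + 0 ℤ.+ ∑ (suc q) (λ j → ε′ * (det p A * cofactorTerm B j))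
    ≡⟨ ℤP.+-identityˡ _ ⟩
  ∑ (suc q) (λ j → ε′ * (det p A * cofactorTerm B j))
    ≡⟨ ∑-*ˡ (suc q) ε′ (λ j → det p A * cofactorTerm B j) ⟩
  ε′ * ∑ (suc q) (λ j → det p A * cofactorTerm B j)
    ≡⟨ cong (ε′ *_) (∑-*ˡ (suc q) (det p A) (cofactorTerm B)) ⟩
  ε′ * (det p A * det (suc q) B) ∎
  where
  open ≡-Reasoning
  ε = shuffleSign s
  ε′ = sign p * ε
  A = leftBlock (R s) M
  B = rightBlock (R s) M

  leftTerm : ∀ i → cofactorTerm M (leftColumn (R s) i) ≡ + 0
  leftTerm i = cofactorTerm-entry0 M _ (proj₂ blk zero _
    (subst (_< p) (sym (toℕ-leftColumn (R s) i)) (FP.toℕ<n i)))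

  rearrange : ∀ (σ τ x ε a b : ℤ) → (σ * τ) * (x * (ε * (a * b))) ≡ (σ * ε) * (a * (τ * (x * b)))
  rearrange = solve-∀

  rightTerm : ∀ j → cofactorTerm M (rightColumn (R s) j) ≡ ε′ * (det p A * cofactorTerm B j)
  rightTerm j = begin
    cofactorTerm M c
      ≡⟨ cong₂ (λ σ d → σ * (B zero j * d)) (trans (cong sign (toℕ-rightColumn (R s) j)) (sign-+ p (toℕ j)))
               (blockDet-s (minor M c) (minor-Block-R s M blk c p≤c)) ⟩
    (sign p * sign (toℕ j)) * (B zero j * (ε * (det p (leftBlock s (minor M c)) * det q (rightBlock s (minor M c)))))
      ≡⟨ cong₂ (λ x y → (sign p * sign (toℕ j)) * (B zero j * (ε * (x * y))))
               (det-cong p (minor-leftBlock-R s M j)) (det-cong q (minor-rightBlock-R s M j)) ⟩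
    (sign p * sign (toℕ j)) * (B zero j * (ε * (det p A * det q (minor B j))))
      ≡⟨ rearrange (sign p) (sign (toℕ j)) (B zero j) ε (det p A) (det q (minor B j)) ⟩
    ε′ * (det p A * cofactorTerm B j) ∎
    where
    c = rightColumn (R s) j
    p≤c = subst (p ≤_) (sym (toℕ-rightColumn (R s) j)) (ℕP.m≤m+n p (toℕ j))

block-det : ∀ {p q n} (s : Shuffle p q n) → BlockDet s
block-det done  M blk = refl
block-det (L s) = block-det-L s (block-det s)
block-det (R s) = block-det-R s (block-det s)

unmerge : ∀ {p q n} → Shuffle p q n → Fin n → Fin p ⊎ Fin q
unmerge (L s) zero    = inj₁ zero
unmerge (L s) (suc r) = ⊎-map suc (λ j → j) (unmerge s r)
unmerge (R s) zero    = inj₂ zero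
unmerge (R s) (suc r) = ⊎-map (λ i → i) suc (unmerge s r)

merge : ∀ {p q n} → Shuffle p q n → Fin p ⊎ Fin q → Fin n
merge s = [ lft s , rgt s ]

merge-unmerge : ∀ {p q n} (s : Shuffle p q n) r → merge s (unmerge s r) ≡ r
merge-unmerge (L s) zero = refl
merge-unmerge (L s) (suc r) with unmerge s r | merge-unmerge s r
... | inj₁ _ | e = cong suc e
... | inj₂ _ | e = cong suc e
merge-unmerge (R s) zero = refl
merge-unmerge (R s) (suc r) with unmerge s r | merge-unmerge s r
... | inj₁ _ | e = cong suc e
... | inj₂ _ | e = cong suc e

unmerge-merge : ∀ {p q n} (s : Shuffle p q n) x → unmerge s (merge s x) ≡ x
unmerge-merge (L s) (inj₁ zero)    = refl
unmerge-merge (L s) (inj₁ (suc i)) = cong (⊎-map suc (λ j → j)) (unmerge-merge s (inj₁ i))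
unmerge-merge (L s) (inj₂ j)       = cong (⊎-map suc (λ j → j)) (unmerge-merge s (inj₂ j))
unmerge-merge (R s) (inj₁ i)       = cong (⊎-map (λ i → i) suc) (unmerge-merge s (inj₁ i))
unmerge-merge (R s) (inj₂ zero)    = refl
unmerge-merge (R s) (inj₂ (suc j)) = cong (⊎-map (λ i → i) suc) (unmerge-merge s (inj₂ j))

shufflePermutation : ∀ {p q} → Shuffle p q (p + q) → Permutation′ (p + q)
shufflePermutation {p} {q} s = permutation (merge s ∘ splitAt p) (join p q ∘ unmerge s)
  (λ r → trans (cong (merge s) (FP.splitAt-join p q (unmerge s r))) (merge-unmerge s r))
  (λ x → trans (cong (join p q) (unmerge-merge s (splitAt p x))) (FP.join-splitAt p q x))

shufflePermutation-left : ∀ {p q} (s : Shuffle p q (p + q)) i → shufflePermutation s ⟨$⟩ʳ (i ↑ˡ q) ≡ lft s i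
shufflePermutation-left {p} {q} s i = cong (merge s) (FP.splitAt-↑ˡ p i q)

shufflePermutation-right : ∀ {p q} (s : Shuffle p q (p + q)) j → shufflePermutation s ⟨$⟩ʳ (p ↑ʳ j) ≡ rgt s j
shufflePermutation-right {p} {q} s j = cong (merge s) (FP.splitAt-↑ʳ p q j)

record RowSorting {n} (P : Fin n → Set) : Set where
  constructor sorting
  field
    lefts rights : ℕ
    shuffle      : Shuffle lefts rights n
    leftRows     : ∀ i → ¬ P (lft shuffle i)
    rightRows    : ∀ j → P (rgt shuffle j)

sortRows : ∀ {n} (P : Fin n → Set) → (∀ r → Dec (P r)) → RowSorting P
sortRows {zero} P P? = sorting 0 0 done (λ ()) (λ ())
sortRows {suc n} P P? with sortRows (P ∘ suc) (P? ∘ suc) | P? zero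
... | sorting p q s fails holds | yes P0 = sorting p (suc q) (R s) fails λ { zero → P0 ; (suc j) → holds j }
... | sorting p q s fails holds | no ¬P0 = sorting (suc p) q (L s) (λ { zero → ¬P0 ; (suc i) → fails i }) holds

splitIndex : ∀ k m (c : Fin (k + m)) → (Σ (Fin k) λ a → a ↑ˡ m ≡ c) ⊎ (Σ (Fin m) λ b → k ↑ʳ b ≡ c)
splitIndex k m c with splitAt k c in split≡
... | inj₁ a = inj₁ (a , FP.splitAt⁻¹-↑ˡ split≡)
... | inj₂ b = inj₂ (b , FP.splitAt⁻¹-↑ʳ split≡)

∧-false-left : ∀ x {y} → y ≡ true → x ∧ y ≡ false → x ≡ false
∧-false-left false _    _ = refl
∧-false-left true  refl ()

module _ {k m : ℕ} (X : Matrix Bool (k + m) (k + m)) where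

  MeetsRight : Fin (k + m) → Set
  MeetsRight r = Σ (Fin m) λ j → X r (k ↑ʳ j) ≡ true

  meetsRight? : ∀ r → Dec (MeetsRight r)
  meetsRight? r = FP.any? λ j → X r (k ↑ʳ j) ≟ᵇ true

  OrthogonalBlocks : Set
  OrthogonalBlocks = (i : Fin k) (j : Fin m) →
    ∑ (k + m) (λ r → toℤMat X r (i ↑ˡ m) * toℤMat X r (k ↑ʳ j)) ≡ + 0

  -- For 0/1 columns orthogonality means disjoint supports, so a row meeting
  -- X₂ vanishes on X₁.
  meetsRight⇒vanishesLeft : OrthogonalBlocks → ∀ r → MeetsRight r → ∀ i → X r (i ↑ˡ m) ≡ false
  meetsRight⇒vanishesLeft orth r (j , meets) i = ∧-false-left (X r (i ↑ˡ m)) meets (disjoint r)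
    where
    disjoint : ∀ r → (X r (i ↑ˡ m) ∧ X r (k ↑ʳ j)) ≡ false
    disjoint = ∑-b2ℤ-zero (k + m) (λ r → X r (i ↑ˡ m) ∧ X r (k ↑ʳ j))
      (trans (∑-cong (k + m) λ r → sym (b2ℤ-∧ (X r (i ↑ˡ m)) (X r (k ↑ʳ j)))) (orth i j))

  ¬meetsRight⇒vanishesRight : ∀ r → ¬ MeetsRight r → ∀ j → X r (k ↑ʳ j) ≡ false
  ¬meetsRight⇒vanishesRight r ¬meets j = ¬-not λ meets → ¬meets (j , meets)

  sorted-Block : ∀ {p q} → OrthogonalBlocks → (s : Shuffle p q (k + m)) →
    (∀ i → ¬ MeetsRight (lft s i)) → (∀ j → MeetsRight (rgt s j)) → Block s k (toℤMat X)
  sorted-Block orth s ¬meets meets = leftVanishes , rightVanishes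
    where
    leftVanishes : ∀ i c → k ≤ toℕ c → toℤMat X (lft s i) c ≡ + 0
    leftVanishes i c k≤c with splitIndex k m c
    ... | inj₁ (a , refl) = ⊥-elim (ℕP.<⇒≱ (subst (_< k) (sym (FP.toℕ-↑ˡ a m)) (FP.toℕ<n a)) k≤c)
    ... | inj₂ (b , refl) = cong b2ℤ (¬meetsRight⇒vanishesRight (lft s i) (¬meets i) b)
    rightVanishes : ∀ j c → toℕ c < k → toℤMat X (rgt s j) c ≡ + 0
    rightVanishes j c c<k with splitIndex k m c
    ... | inj₁ (a , refl) = cong b2ℤ (meetsRight⇒vanishesLeft orth (rgt s j) (meets j) a)
    ... | inj₂ (b , refl) = ⊥-elim (ℕP.<⇒≱ c<k (subst (k ≤_) (sym (FP.toℕ-↑ʳ k b)) (ℕP.m≤m+n k (toℕ b))))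

  sorting-sizes : Nonsingular X → OrthogonalBlocks → (srt : RowSorting MeetsRight) →
    RowSorting.lefts srt ≡ k × RowSorting.rights srt ≡ m
  sorting-sizes nonsingular orth (sorting p q s ¬meets meets) with p ≟ k
  ... | no p≢k = ⊥-elim (nonsingular (block-singular s k (toℤMat X)
                   (sorted-Block orth s ¬meets meets) (ℕP.m≤m+n k m) p≢k))
  ... | yes refl = refl , sym (ℕP.+-cancelˡ-≡ k m q (size s))

  BlockDiagonalBy : Permutation′ (k + m) → Set
  BlockDiagonalBy π =
    ((i : Fin k) (j : Fin m) → X (π ⟨$⟩ʳ (i ↑ˡ m)) (k ↑ʳ j) ≡ false) ×
    ((i : Fin m) (j : Fin k) → X (π ⟨$⟩ʳ (k ↑ʳ i)) (j ↑ˡ m) ≡ false) ×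
    Nonsingular {k} (λ i j → X (π ⟨$⟩ʳ (i ↑ˡ m)) (j ↑ˡ m)) ×
    Nonsingular {m} (λ i j → X (π ⟨$⟩ʳ (k ↑ʳ i)) (k ↑ʳ j))

  -- A sorting with k left rows block-diagonalises X: the off-diagonal blocks
  -- vanish by construction, and by the product formula both diagonal blocks
  -- are nonsingular.
  sorted-blockDiagonal : Nonsingular X → OrthogonalBlocks → (s : Shuffle k m (k + m)) →
    (∀ i → ¬ MeetsRight (lft s i)) → (∀ j → MeetsRight (rgt s j)) →
    BlockDiagonalBy (shufflePermutation s)
  sorted-blockDiagonal nonsingular orth s ¬meets meets =
    upperRightZero , lowerLeftZero , proj₁ factorsNonzero ∘ upperDet , proj₂ factorsNonzero ∘ lowerDet
    where
    π = shufflePermutation s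
    M = toℤMat X
    factorsNonzero : ¬ det k (leftBlock s M) ≡ + 0 × ¬ det m (rightBlock s M) ≡ + 0
    factorsNonzero = nonzero-factors {ε = shuffleSign s} nonsingular
      (block-det s M (sorted-Block orth s ¬meets meets))

    upperRightZero : ∀ i j → X (π ⟨$⟩ʳ (i ↑ˡ m)) (k ↑ʳ j) ≡ false
    upperRightZero i j rewrite shufflePermutation-left s i =
      ¬meetsRight⇒vanishesRight (lft s i) (¬meets i) j

    lowerLeftZero : ∀ i j → X (π ⟨$⟩ʳ (k ↑ʳ i)) (j ↑ˡ m) ≡ false
    lowerLeftZero i j rewrite shufflePermutation-right s i =
      meetsRight⇒vanishesLeft orth (rgt s i) (meets i) j

    upperDet : det k (toℤMat λ i j → X (π ⟨$⟩ʳ (i ↑ˡ m)) (j ↑ˡ m)) ≡ + 0 → det k (leftBlock s M) ≡ + 0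
    upperDet = trans (det-cong k λ a b →
      cong₂ (λ r c → b2ℤ (X r c)) (sym (shufflePermutation-left s a)) (leftColumn-↑ˡ s b))

    lowerDet : det m (toℤMat λ i j → X (π ⟨$⟩ʳ (k ↑ʳ i)) (k ↑ʳ j)) ≡ + 0 → det m (rightBlock s M) ≡ + 0
    lowerDet = trans (det-cong m λ a b →
      cong₂ (λ r c → b2ℤ (X r c)) (sym (shufflePermutation-right s a)) (rightColumn-↑ʳ s b))

  blockDiagonal : Nonsingular X → OrthogonalBlocks → RowSorting MeetsRight →
    Σ (Permutation′ (k + m)) BlockDiagonalBy
  blockDiagonal nonsingular orth srt@(sorting p q s ¬meets meets) with sorting-sizes nonsingular orth srt
  ... | refl , refl = shufflePermutation s , sorted-blockDiagonal nonsingular orth s ¬meets meets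

-- The theorem.
lemma2p3 : (k m : ℕ) → 1 ≤ k → 1 ≤ m →
    (X : Matrix Bool (k + m) (k + m)) →
    Nonsingular X →
    ((i : Fin k) (j : Fin m) → ∑ (k + m) (λ r → toℤMat X r (i ↑ˡ m) * toℤMat X r (k ↑ʳ j)) ≡ + 0) →
    Σ (Permutation′ (k + m)) (λ π →
      ((i : Fin k) (j : Fin m) → X (π ⟨$⟩ʳ (i ↑ˡ m)) (k ↑ʳ j) ≡ false) ×
      ((i : Fin m) (j : Fin k) → X (π ⟨$⟩ʳ (k ↑ʳ i)) (j ↑ˡ m) ≡ false) ×
      Nonsingular {k} (λ i j → X (π ⟨$⟩ʳ (i ↑ˡ m)) (j ↑ˡ m)) ×
      Nonsingular {m} (λ i j → X (π ⟨$⟩ʳ (k ↑ʳ i)) (k ↑ʳ j)))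
lemma2p3 k m _ _ X nonsingular orthogonal =
  blockDiagonal X nonsingular orthogonal (sortRows (MeetsRight X) (meetsRight? X))
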